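{- Let $m\geq 4$ be an integer and let $t$ be a positive integer such that $p:=\gcd(m,t)$ is a prime and $t+p=2m$. Define a sequence $(c(n))_{n\geq m-1}$ by $c(m-1)=t$ and, for $n\geq m$, $$c(n)=c(n-1)+\gcd(n,\,c(n-1)).$$ Then for every $n\geq m$, the difference $c(n)-c(n-1)$ is either $1$ or a prime. -}

module Defs where

open import Data.Nat using (ℕ; zero; suc; _+_; _∸_)
open import Data.Nat.GCD using (gcd)

-- shifted sequence: cs m t k = c(m - 1 + k)
cs : ℕ → ℕ → ℕ → ℕ
cs m t zero = t
cs m t (suc k) = cs m t k + gcd (m ∸ 1 + suc k) (cs m t k)

-- c m t n = c(n) for n ≥ m - 1 (values for n < m - 1 are irrelevant)
c : ℕ → ℕ → ℕ → ℕ
c m t n = cs m t (n ∸ (m ∸ 1))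

{-# OPTIONS --safe #-}
-- Write c(n) = (n + 1) + L with n + 1 = L + j, where L has no non-trivial divisor
-- below j. Then gcd(n + 1, c(n)) = gcd(j, L), which is either 1, so that the same L
-- works with j + 1, or j itself, in which case j divides L and is therefore prime,
-- and c(n + 1) = 2(n + 1) restarts the pattern with L = n, j = 2. The first step
-- adds the prime gcd(m, t) and lands on such a restart: c(m) = t + gcd(m, t) = 2m.
module Submission where

open import Defs
open import Data.Nat using (ℕ; _+_; _*_; _∸_; _≥_)
open import Data.Nat.GCD using (gcd)
open import Data.Nat.Primality using (Prime)
open import Data.Sum using (_⊎_)
open import Relation.Binary.PropositionalEquality using (_≡_)

open import Data.Nat.Base
  using (zero; suc; 2+; s≤s; NonZero; NonTrivial; ≢-nonZero⁻¹; nonTrivial⇒nonZero; nonTrivial⇒n>1; n>1⇒nonTrivial; nonTrivial⇒≢1)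
open import Data.Nat.Properties
  using (≤-antisym; ≮⇒≥; m<n⇒m<1+n; +-suc; +-comm; +-assoc; +-identityʳ; +-∸-assoc; m+n∸m≡n)
open import Data.Nat.Divisibility
  using (_∣_; _∤_; hasNonTrivialDivisor; 0∣⇒≡0; ∣-refl; ∣-trans; ∣⇒≤; ∣1⇒≡1; ∣m∣n⇒∣m+n; ∣m+n∣m⇒∣n)
open import Data.Nat.GCD using (gcd-comm; gcd-greatest; gcd-universality; gcd[m,n]∣m; gcd[m,n]∣n)
open import Data.Nat.Primality using (_Rough_; 2-rough; ∤⇒rough-suc; rough∧∣⇒prime)
open import Data.Nat.Tactic.RingSolver using (solve-∀)
open import Data.Product using (_×_; _,_)
open import Data.Sum using (inj₁; inj₂; [_,_]′)
open import Relation.Nullary.Negation using (contradiction)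
open import Relation.Binary.PropositionalEquality
  using (refl; sym; trans; cong; cong₂; subst; subst₂; module ≡-Reasoning)

gcd[m,m+n]≡gcd[m,n] : ∀ m n → gcd m (m + n) ≡ gcd m n
gcd[m,m+n]≡gcd[m,n] m n = gcd-universality forwards backwards
  where
  forwards : ∀ {d} → d ∣ m × d ∣ n → d ∣ gcd m (m + n)
  forwards (d∣m , d∣n) = gcd-greatest d∣m (∣m∣n⇒∣m+n d∣m d∣n)
  backwards : ∀ {d} → d ∣ gcd m (m + n) → d ∣ m × d ∣ n
  backwards d∣g = d∣m , ∣m+n∣m⇒∣n (∣-trans d∣g (gcd[m,n]∣n m (m + n))) d∣m
    where d∣m = ∣-trans d∣g (gcd[m,n]∣m m (m + n))

gcd[m+n,m+n+m]≡gcd[n,m] : ∀ m n → gcd (m + n) (m + n + m) ≡ gcd n m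
gcd[m+n,m+n+m]≡gcd[n,m] m n = begin
  gcd (m + n) (m + n + m) ≡⟨ gcd[m,m+n]≡gcd[m,n] (m + n) m ⟩
  gcd (m + n) m           ≡⟨ gcd-comm (m + n) m ⟩
  gcd m (m + n)           ≡⟨ gcd[m,m+n]≡gcd[m,n] m n ⟩
  gcd m n                 ≡⟨ gcd-comm m n ⟩
  gcd n m                 ∎
  where open ≡-Reasoning

rough⇒gcd≡1⊎gcd≡ : ∀ {j n} .{{_ : NonZero j}} → j Rough n → gcd j n ≡ 1 ⊎ gcd j n ≡ j
rough⇒gcd≡1⊎gcd≡ {j} {n} rough with gcd j n | gcd[m,n]∣m j n | gcd[m,n]∣n j n
... | zero       | 0∣j | _   = contradiction (0∣⇒≡0 0∣j) (≢-nonZero⁻¹ j)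
... | suc zero   | _   | _   = inj₁ refl
... | g@(2+ _)   | g∣j | g∣n =
  inj₂ (≤-antisym (∣⇒≤ g∣j) (≮⇒≥ λ g<j → rough (hasNonTrivialDivisor g<j g∣n)))

OneOrPrime : ℕ → Set
OneOrPrime d = d ≡ 1 ⊎ Prime d

record Stage (n x : ℕ) : Set where
  field
    L j           : ℕ
    suc-n≡L+j     : suc n ≡ L + j
    x≡suc-n+L     : x ≡ suc n + L
    {{j-nonTrivial}} : NonTrivial j
    j-rough-L     : j Rough L

2*[1+n]≡[2+n]+n : ∀ n → 2 * suc n ≡ suc (suc n) + n
2*[1+n]≡[2+n]+n = solve-∀

stage-double : ∀ n → Stage (suc n) (2 * suc n)
stage-double n = record
  { L = n
  ; j = 2
  ; suc-n≡L+j = +-comm 2 n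
  ; x≡suc-n+L = 2*[1+n]≡[2+n]+n n
  ; j-rough-L = 2-rough
  }

module _ {n x : ℕ} (stage : Stage n x) where
  open Stage stage
  open ≡-Reasoning

  private instance
    j-nonZero : NonZero j
    j-nonZero = nonTrivial⇒nonZero j

  gcd≡gcd[j,L] : gcd (suc n) x ≡ gcd j L
  gcd≡gcd[j,L] = begin
    gcd (suc n) x           ≡⟨ cong (gcd (suc n)) x≡suc-n+L ⟩
    gcd (suc n) (suc n + L) ≡⟨ cong (λ a → gcd a (a + L)) suc-n≡L+j ⟩
    gcd (L + j) (L + j + L) ≡⟨ gcd[m+n,m+n+m]≡gcd[n,m] L j ⟩
    gcd j L                 ∎

  stage-coprime : gcd j L ≡ 1 → Stage (suc n) (x + gcd (suc n) x)
  stage-coprime g≡1 = record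
    { L = L
    ; j = suc j
    ; suc-n≡L+j = trans (cong suc suc-n≡L+j) (sym (+-suc L j))
    ; x≡suc-n+L = begin
        x + gcd (suc n) x ≡⟨ cong₂ _+_ x≡suc-n+L (trans gcd≡gcd[j,L] g≡1) ⟩
        suc n + L + 1     ≡⟨ +-comm (suc n + L) 1 ⟩
        suc (suc n + L)   ∎
    ; j-nonTrivial = n>1⇒nonTrivial (m<n⇒m<1+n (nonTrivial⇒n>1 j))
    ; j-rough-L = ∤⇒rough-suc j∤L j-rough-L
    }
    where
    j∤L : j ∤ L
    j∤L j∣L = nonTrivial⇒≢1 (∣1⇒≡1 (subst (j ∣_) g≡1 (gcd-greatest ∣-refl j∣L)))

  stage-restart : gcd j L ≡ j → Stage (suc n) (x + gcd (suc n) x)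
  stage-restart g≡j = subst (Stage (suc n)) (sym x+gcd≡2*suc-n) (stage-double n)
    where
    x+gcd≡2*suc-n : x + gcd (suc n) x ≡ 2 * suc n
    x+gcd≡2*suc-n = begin
      x + gcd (suc n) x   ≡⟨ cong₂ _+_ x≡suc-n+L (trans gcd≡gcd[j,L] g≡j) ⟩
      suc n + L + j       ≡⟨ +-assoc (suc n) L j ⟩
      suc n + (L + j)     ≡⟨ cong (suc n +_) (sym suc-n≡L+j) ⟩
      suc n + suc n       ≡⟨ cong (suc n +_) (sym (+-identityʳ (suc n))) ⟩
      2 * suc n           ∎

  stage-suc : Stage (suc n) (x + gcd (suc n) x)
  stage-suc = [ stage-coprime , stage-restart ]′ (rough⇒gcd≡1⊎gcd≡ j-rough-L)

  stage⇒gcd≡1⊎prime : OneOrPrime (gcd (suc n) x)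
  stage⇒gcd≡1⊎prime with rough⇒gcd≡1⊎gcd≡ j-rough-L
  ... | inj₁ g≡1 = inj₁ (trans gcd≡gcd[j,L] g≡1)
  ... | inj₂ g≡j = inj₂ (subst Prime (sym (trans gcd≡gcd[j,L] g≡j)) (rough∧∣⇒prime j-rough-L j∣L))
    where
    j∣L : j ∣ L
    j∣L = subst (_∣ L) g≡j (gcd[m,n]∣n j L)

cs-diff : ∀ m t k → cs m t (suc k) ∸ cs m t k ≡ gcd (m ∸ 1 + suc k) (cs m t k)
cs-diff m t k = m+n∸m≡n (cs m t k) (gcd (m ∸ 1 + suc k) (cs m t k))

module _ (M t : ℕ) where

  cs-suc : ∀ k → cs (suc M) t (suc k) ≡ cs (suc M) t k + gcd (suc (M + k)) (cs (suc M) t k)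
  cs-suc k = cong (λ a → cs (suc M) t k + gcd a (cs (suc M) t k)) (+-suc M k)

  stage-cs : t + gcd (suc M) t ≡ 2 * suc M → ∀ k → Stage (M + suc k) (cs (suc M) t (suc k))
  stage-cs doubling zero = subst₂ Stage (+-comm 1 M) (sym cs[1]≡2*suc-M) (stage-double M)
    where
    cs[1]≡2*suc-M : cs (suc M) t 1 ≡ 2 * suc M
    cs[1]≡2*suc-M = trans (cong (λ a → t + gcd a t) (+-comm M 1)) doubling
  stage-cs doubling (suc k) =
    subst₂ Stage (sym (+-suc M (suc k))) (sym (cs-suc (suc k))) (stage-suc (stage-cs doubling k))

  gcd-step-cs : Prime (gcd (suc M) t) → t + gcd (suc M) t ≡ 2 * suc M →
                ∀ k → OneOrPrime (gcd (M + suc k) (cs (suc M) t k))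
  gcd-step-cs gcd-prime doubling zero    = inj₂ (subst (λ a → Prime (gcd a t)) (+-comm 1 M) gcd-prime)
  gcd-step-cs gcd-prime doubling (suc k) =
    subst (λ a → OneOrPrime (gcd a (cs (suc M) t (suc k))))
          (sym (+-suc M (suc k))) (stage⇒gcd≡1⊎prime (stage-cs doubling k))

theorem4 : (m t : ℕ) → m ≥ 4 → t ≥ 1 → Prime (gcd m t) → t + gcd m t ≡ 2 * m →
             (n : ℕ) → n ≥ m →
             (c m t n ∸ c m t (n ∸ 1) ≡ 1) ⊎ Prime (c m t n ∸ c m t (n ∸ 1))
theorem4 zero    t () _ _ _ _ _
theorem4 (suc M) t _ _ gcd-prime doubling (suc n) (s≤s M≤n)
  rewrite +-∸-assoc 1 M≤n | cs-diff (suc M) t (n ∸ M) = gcd-step-cs M t gcd-prime doubling (n ∸ M)
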